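{- Let $P$ be an octahedron (the $3$-dimensional cross polytope). Then its face lattice $L(P)$ is not isomorphic to the core of any upho lattice.
   Context: The face lattice of a polytope is the poset of its faces (including the empty face and the polytope itself) ordered by inclusion; it is a finite graded lattice with rank of a face $F$ equal to $\dim F+1$. A poset $\mathcal{P}$ is finite type $\mathbb{N}$-graded if it has a minimum $\hat0$, a rank function $\rho$ with $\rho(\hat0)=0$ such that every maximal chain has the form $\hat0=x_0\lessdot x_1\lessdot\cdots$ with $\rho(x_i)=i$, and finitely many elements of each rank. An upho lattice is a finite type $\mathbb{N}$-graded lattice $\mathcal{L}$ with at least two elements such that for every $p\in\mathcal{L}$ the principal filter $\{q\ge p\}$ is isomorphic to $\mathcal{L}$. Its core is the interval $[\hat0,s_1\vee\cdots\vee s_r]$ with $s_1,\ldots,s_r$ the atoms of $\mathcal{L}$. -}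

module Defs where

open import Level using (Level; _⊔_) renaming (suc to lsuc)
open import Data.Nat using (ℕ; zero; suc)
import Data.Nat
open import Data.Fin using (Fin)
open import Data.Bool using (Bool)
open import Data.Maybe using (Maybe; just; nothing)
open import Data.List using (List)
open import Data.List.Membership.Propositional using (_∈_)
open import Data.Product using (Σ; ∃; _×_; _,_; proj₁; proj₂)
open import Data.Sum using (_⊎_)
open import Data.Empty using (⊥)
import Data.Unit
open import Relation.Nullary using (¬_)
open import Relation.Binary.Core using (Rel)
open import Relation.Binary.PropositionalEquality using (_≡_)
open import Relation.Binary.Definitions using (Minimum)
open import Relation.Binary.Lattice.Structures using (IsLattice)

record _≅ₚ_ {a b ℓ₁ ℓ₂} (P : Σ (Set a) (λ A → Rel A ℓ₁))
                        (Q : Σ (Set b) (λ B → Rel B ℓ₂))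
                        : Set (a ⊔ b ⊔ ℓ₁ ⊔ ℓ₂) where
  private
    A = proj₁ P
    _≤A_ = proj₂ P
    B = proj₁ Q
    _≤B_ = proj₂ Q
  field
    to       : A → B
    from     : B → A
    from∘to  : ∀ x → from (to x) ≡ x
    to∘from  : ∀ y → to (from y) ≡ y
    mono     : ∀ {x y} → x ≤A y → to x ≤B to y
    reflects : ∀ {x y} → to x ≤B to y → x ≤A y

infix 4 _≅ₚ_

module _ {a ℓ} {C : Set a} (_≤_ : Rel C ℓ) where

  SubPoset : ∀ {p} (S : C → Set p) → Σ (Set (a ⊔ p)) (λ A → Rel A ℓ)
  SubPoset S = Σ C S , (λ x y → proj₁ x ≤ proj₁ y)

  Filter : C → Σ (Set (a ⊔ ℓ)) (λ A → Rel A ℓ)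
  Filter p = SubPoset (λ q → p ≤ q)

  Ideal : C → Σ (Set (a ⊔ ℓ)) (λ A → Rel A ℓ)
  Ideal t = SubPoset (λ x → x ≤ t)

  _<ₚ_ : C → C → Set (a ⊔ ℓ)
  x <ₚ y = x ≤ y × ¬ (x ≡ y)

  _⋖_ : C → C → Set (a ⊔ ℓ)
  x ⋖ y = x <ₚ y × (∀ z → x ≤ z → z ≤ y → (z ≡ x) ⊎ (z ≡ y))

record UphoLattice (a ℓ : Level) : Set (lsuc (a ⊔ ℓ)) where
  field
    Carrier : Set a
    _≤_     : Rel Carrier ℓ
    ≤-irrelevant : ∀ {x y} (p q : x ≤ y) → p ≡ q
    _∨_ _∧_ : Carrier → Carrier → Carrier
    isLattice : IsLattice _≡_ _≤_ _∨_ _∧_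
    𝟘        : Carrier
    minimum  : Minimum _≤_ 𝟘
    ρ        : Carrier → ℕ
    ρ-𝟘      : ρ 𝟘 ≡ 0
    ρ-strict : ∀ {x y} → _<ₚ_ _≤_ x y → ρ x Data.Nat.< ρ y
    ρ-cover  : ∀ {x y} → _⋖_ _≤_ x y → ρ y ≡ suc (ρ x)
    finiteRank : ∀ n → Σ (List Carrier) (λ xs → ∀ x → ρ x ≡ n → x ∈ xs)
    nontrivial : Σ Carrier (λ x → Σ Carrier (λ y → ¬ (x ≡ y)))
    upho : ∀ p → Filter _≤_ p ≅ₚ (Carrier , _≤_)

  poset : Σ (Set a) (λ A → Rel A ℓ)
  poset = Carrier , _≤_

  Atom : Carrier → Set (a ⊔ ℓ)
  Atom s = _⋖_ _≤_ 𝟘 s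

  IsJoinOfAtoms : Carrier → Set (a ⊔ ℓ)
  IsJoinOfAtoms t = (∀ s → Atom s → s ≤ t)
                  × (∀ u → (∀ s → Atom s → s ≤ u) → t ≤ u)

  Core : Carrier → Σ (Set (a ⊔ ℓ)) (λ A → Rel A ℓ)
  Core t = Ideal _≤_ t

-- Face lattice of the octahedron (3-dimensional cross polytope)
-- Vertices: ±eᵢ, encoded as (i , b) with b = true for +eᵢ.
-- Faces: the empty face, the proper faces (vertex sets containing no
-- antipodal pair: a choice, for each coordinate i, of nothing, +eᵢ or -eᵢ),
-- and the whole polytope.

OctVertex : Set
OctVertex = Fin 3 × Bool

data OctFace : Set where
  proper : (Fin 3 → Maybe Bool) → OctFace   -- includes the empty face
  whole  : OctFace

_∈ᵥ_ : OctVertex → OctFace → Set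
v ∈ᵥ proper s = s (proj₁ v) ≡ just (proj₂ v)
v ∈ᵥ whole    = Data.Unit.⊤


_⊆F_ : OctFace → OctFace → Set
F ⊆F G = ∀ v → v ∈ᵥ F → v ∈ᵥ G

OctFaceLattice : Σ Set (λ A → Rel A Level.zero)
OctFaceLattice = OctFace , _⊆F_

-- Call a tall join above b a pair of distinct upper covers x, y of b whose join lies two
-- covering steps above x. In the octahedron P there is one above every vertex v, since [v, P] is
-- the face lattice of a square, but none above the empty face: two distinct vertices join to an
-- edge covering both, or to P, three steps above each. Tall joins are order-theoretic, so they move
-- along isomorphisms and between L and its convex subposets. Upper homogeneity at the image of v
-- carries one to the bottom of L, and since atoms lie below t it stays inside the core,
-- contradicting the above.

{-# OPTIONS --safe #-}
module Submission where

open import Defs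
open import Level using (Level; _⊔_; 0ℓ)
open import Data.Bool using (Bool; true; false)
import Data.Bool.Properties as Bool
open import Data.Maybe using (Maybe; just; nothing)
import Data.Maybe.Properties as Maybe
open import Data.Nat using (ℕ; zero; suc)
open import Data.Fin using (zero)
open import Data.Vec using (Vec; []; _∷_; replicate; lookup; tabulate)
open import Data.Vec.Properties as Vec using (tabulate∘lookup; lookup∘tabulate)
open import Data.Vec.Relation.Binary.Pointwise.Inductive as Pointwise using (Pointwise; []; _∷_)
open import Data.Product using (Σ; _×_; _,_; proj₁; proj₂)
import Data.Sum as Sum
open import Data.Unit using (tt)
open import Function using (_∘_)
open import Relation.Nullary using (¬_; Dec; yes; no)
open import Relation.Nullary.Decidable using (map′; _×-dec_; _⊎-dec_; _→-dec_; ¬?; from-yes)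
open import Relation.Unary using (Pred)
import Relation.Unary as U
open import Relation.Binary.Core using (Rel)
open import Relation.Binary.Definitions
  using (Minimum; Antisymmetric; Transitive; Decidable; DecidableEquality)
open import Relation.Binary.PropositionalEquality
  using (_≡_; _≢_; refl; sym; trans; cong; subst; subst₂)
open import Relation.Binary.Lattice.Structures using (IsLattice)

module _ {a ℓ} (P : Σ (Set a) (λ A → Rel A ℓ)) where
  private
    A = proj₁ P
    _≤_ = proj₂ P

  IsJoin : A → A → A → Set (a ⊔ ℓ)
  IsJoin x y j = x ≤ j × y ≤ j × (∀ u → x ≤ u → y ≤ u → j ≤ u)

  record TallJoin (b : A) : Set (a ⊔ ℓ) where
    field
      x y g j : A
      b⋖x   : _⋖_ _≤_ b x
      b⋖y   : _⋖_ _≤_ b y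
      x≢y   : x ≢ y
      x⋖g   : _⋖_ _≤_ x g
      g⋖j   : _⋖_ _≤_ g j
      x∨y≡j : IsJoin x y j

module _ {a b ℓ₁ ℓ₂} {P : Σ (Set a) (λ A → Rel A ℓ₁)} {Q : Σ (Set b) (λ B → Rel B ℓ₂)}
         (i : P ≅ₚ Q) where
  open _≅ₚ_ i
  private
    _≤P_ = proj₂ P
    _≤Q_ = proj₂ Q

  ≅ₚ-sym : Q ≅ₚ P
  ≅ₚ-sym = record
    { to       = from
    ; from     = to
    ; from∘to  = to∘from
    ; to∘from  = from∘to
    ; mono     = λ y≤y′ → reflects (subst₂ _≤Q_ (sym (to∘from _)) (sym (to∘from _)) y≤y′)
    ; reflects = λ x≤x′ → subst₂ _≤Q_ (to∘from _) (to∘from _) (mono x≤x′)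
    }

  to-injective : ∀ {x y} → to x ≡ to y → x ≡ y
  to-injective {x} {y} e = trans (sym (from∘to x)) (trans (cong from e) (from∘to y))

  private
    to-≤ : ∀ {x y} → x ≤P from y → to x ≤Q y
    to-≤ {x} {y} x≤y = subst (to x ≤Q_) (to∘from y) (mono x≤y)

    from-≥ : ∀ {x z} → to x ≤Q z → x ≤P from z
    from-≥ {x} {z} x≤z = reflects (subst (to x ≤Q_) (sym (to∘from z)) x≤z)

    from-≤ : ∀ {z y} → z ≤Q to y → from z ≤P y
    from-≤ {z} {y} z≤y = reflects (subst (_≤Q to y) (sym (to∘from z)) z≤y)

    from≡⇒≡to : ∀ {z x} → from z ≡ x → z ≡ to x
    from≡⇒≡to {z} e = trans (sym (to∘from z)) (cong to e)

  to-⋖ : ∀ {x y} → _⋖_ _≤P_ x y → _⋖_ _≤Q_ (to x) (to y)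
  to-⋖ ((x≤y , x≢y) , between) =
    (mono x≤y , x≢y ∘ to-injective) ,
    λ z x≤z z≤y → Sum.map from≡⇒≡to from≡⇒≡to (between (from z) (from-≥ x≤z) (from-≤ z≤y))

  to-isJoin : ∀ {x y j} → IsJoin P x y j → IsJoin Q (to x) (to y) (to j)
  to-isJoin (x≤j , y≤j , least) =
    mono x≤j , mono y≤j , λ u x≤u y≤u → to-≤ (least (from u) (from-≥ x≤u) (from-≥ y≤u))

  to-minimum : ∀ {m} → Minimum _≤P_ m → Minimum _≤Q_ (to m)
  to-minimum m≤ y = to-≤ (m≤ (from y))

  to-tallJoin : ∀ {b} → TallJoin P b → TallJoin Q (to b)
  to-tallJoin t = record
    { x = to x ; y = to y ; g = to g ; j = to j
    ; b⋖x = to-⋖ b⋖x ; b⋖y = to-⋖ b⋖y ; x≢y = x≢y ∘ to-injective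
    ; x⋖g = to-⋖ x⋖g ; g⋖j = to-⋖ g⋖j ; x∨y≡j = to-isJoin x∨y≡j
    }
    where open TallJoin t

Convex : ∀ {a ℓ p} {C : Set a} → Rel C ℓ → Pred C p → Set (a ⊔ ℓ ⊔ p)
Convex _≤_ S = ∀ {x y z} → S x → S z → x ≤ y → y ≤ z → S y

proj₁-injective : ∀ {a p} {C : Set a} {S : Pred C p} → U.Irrelevant S →
                  ∀ {u v : Σ C S} → proj₁ u ≡ proj₁ v → u ≡ v
proj₁-injective S-irrelevant {x , p} {_ , q} refl = cong (x ,_) (S-irrelevant p q)

module _ {a ℓ p} {C : Set a} {_≤_ : Rel C ℓ} {S : Pred C p} (S-irrelevant : U.Irrelevant S) where
  private
    _≤ₛ_ = proj₂ (SubPoset _≤_ S)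

  SubPoset-antisym : Antisymmetric _≡_ _≤_ → Antisymmetric _≡_ _≤ₛ_
  SubPoset-antisym antisym u≤v v≤u = proj₁-injective S-irrelevant (antisym u≤v v≤u)

  ⋖⇒⋖ₛ : ∀ {x y} {sx : S x} {sy : S y} → _⋖_ _≤_ x y → _⋖_ _≤ₛ_ (x , sx) (y , sy)
  ⋖⇒⋖ₛ ((x≤y , x≢y) , between) =
    (x≤y , x≢y ∘ cong proj₁) ,
    λ z x≤z z≤y → Sum.map (proj₁-injective S-irrelevant) (proj₁-injective S-irrelevant)
                          (between (proj₁ z) x≤z z≤y)

  ⋖ₛ⇒⋖ : Convex _≤_ S → ∀ {u v} → _⋖_ _≤ₛ_ u v → _⋖_ _≤_ (proj₁ u) (proj₁ v)
  ⋖ₛ⇒⋖ convex {_ , su} {_ , sv} ((x≤y , u≢v) , between) =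
    (x≤y , u≢v ∘ proj₁-injective S-irrelevant) ,
    λ z x≤z z≤y → Sum.map (cong proj₁) (cong proj₁) (between (z , convex su sv x≤z z≤y) x≤z z≤y)

  restrict-tallJoin : Transitive _≤_ → Convex _≤_ S → ∀ {b} (t : TallJoin (C , _≤_) b) →
                      (sb : S b) → S (TallJoin.j t) → TallJoin (SubPoset _≤_ S) (b , sb)
  restrict-tallJoin ≤-trans convex t sb sj = record
    { x = x , sx ; y = y , sy ; g = g , convex sb sj (≤-trans b≤x x≤g) g≤j ; j = j , sj
    ; b⋖x = ⋖⇒⋖ₛ b⋖x ; b⋖y = ⋖⇒⋖ₛ b⋖y ; x≢y = x≢y ∘ cong proj₁
    ; x⋖g = ⋖⇒⋖ₛ x⋖g ; g⋖j = ⋖⇒⋖ₛ g⋖j ; x∨y≡j = x≤j , y≤j , λ u → least (proj₁ u)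
    }
    where
    open TallJoin t
    x≤j = proj₁ x∨y≡j
    y≤j = proj₁ (proj₂ x∨y≡j)
    least = proj₂ (proj₂ x∨y≡j)
    b≤x = proj₁ (proj₁ b⋖x)
    x≤g = proj₁ (proj₁ x⋖g)
    g≤j = proj₁ (proj₁ g⋖j)
    sx = convex sb sj b≤x x≤j
    sy = convex sb sj (proj₁ (proj₁ b⋖y)) y≤j

module _ {a ℓ} (L : UphoLattice a ℓ) where
  open UphoLattice L
  open IsLattice isLattice using (antisym; x≤x∨y; y≤x∨y; ∨-least)
    renaming (refl to ≤-refl; trans to ≤-trans)

  private
    ≥-convex : ∀ b → Convex _≤_ (b ≤_)
    ≥-convex b b≤x _ x≤y _ = ≤-trans b≤x x≤y

    ≤-convex : ∀ t → Convex _≤_ (_≤ t)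
    ≤-convex t _ z≤t _ y≤z = ≤-trans y≤z z≤t

  core-antisym : ∀ t → Antisymmetric _≡_ (proj₂ (Core t))
  core-antisym t = SubPoset-antisym ≤-irrelevant antisym

  ideal-isJoin⇒isJoin : ∀ {t x y j} → IsJoin (Ideal _≤_ t) x y j →
                        IsJoin poset (proj₁ x) (proj₁ y) (proj₁ j)
  ideal-isJoin⇒isJoin {x = x , _} {y , _} {_ , j≤t} (x≤j , y≤j , least) =
    x≤j , y≤j ,
    λ u x≤u y≤u → ≤-trans (least (x ∨ y , ≤-trans (∨-least x≤j y≤j) j≤t) (x≤x∨y x y) (y≤x∨y x y))
                          (∨-least x≤u y≤u)

  ideal-tallJoin⇒tallJoin : ∀ {t b} → TallJoin (Ideal _≤_ t) b → TallJoin poset (proj₁ b)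
  ideal-tallJoin⇒tallJoin {t} tj = record
    { x = proj₁ x ; y = proj₁ y ; g = proj₁ g ; j = proj₁ j
    ; b⋖x = ⋖⇒⋖ b⋖x ; b⋖y = ⋖⇒⋖ b⋖y ; x≢y = x≢y ∘ proj₁-injective ≤-irrelevant
    ; x⋖g = ⋖⇒⋖ x⋖g ; g⋖j = ⋖⇒⋖ g⋖j ; x∨y≡j = ideal-isJoin⇒isJoin {t} {x} {y} {j} x∨y≡j
    }
    where
    open TallJoin tj
    ⋖⇒⋖ = ⋖ₛ⇒⋖ {S = _≤ t} ≤-irrelevant (≤-convex t)

  tallJoin⇒tallJoin-𝟘 : ∀ {b} → TallJoin poset b → TallJoin poset 𝟘
  tallJoin⇒tallJoin-𝟘 {b} tj =
    subst (TallJoin poset) bottom↦𝟘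
      (to-tallJoin Φ (restrict-tallJoin ≤-irrelevant ≤-trans (≥-convex b) tj ≤-refl b≤j))
    where
    open TallJoin tj
    Φ = upho b
    b≤j = ≤-trans (proj₁ (proj₁ b⋖x)) (proj₁ x∨y≡j)
    bottom↦𝟘 : _≅ₚ_.to Φ (b , ≤-refl) ≡ 𝟘
    bottom↦𝟘 = antisym (to-minimum Φ proj₂ 𝟘) (minimum _)

  tallJoin-𝟘⇒core : ∀ {t} → (∀ s → Atom s → s ≤ t) → TallJoin poset 𝟘 →
                    TallJoin (Core t) (𝟘 , minimum t)
  tallJoin-𝟘⇒core {t} atoms≤t tj =
    restrict-tallJoin ≤-irrelevant ≤-trans (≤-convex t) tj (minimum t)
      (proj₂ (proj₂ x∨y≡j) t (atoms≤t x b⋖x) (atoms≤t y b⋖y))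
    where open TallJoin tj

Exhaustible : Set → Set₁
Exhaustible A = ∀ {P : Pred A 0ℓ} → U.Decidable P → Dec (∀ x → P x)

module FiniteDecidable {A : Set} {_≤_ : Rel A 0ℓ} (_≟_ : DecidableEquality A)
                       (_≤?_ : Decidable _≤_) (∀? : Exhaustible A) where

  _⋖?_ : Decidable (_⋖_ _≤_)
  x ⋖? y = ((x ≤? y) ×-dec ¬? (x ≟ y))
    ×-dec ∀? λ z → (x ≤? z) →-dec (z ≤? y) →-dec ((z ≟ x) ⊎-dec (z ≟ y))

  isJoin? : ∀ x y j → Dec (IsJoin (A , _≤_) x y j)
  isJoin? x y j = (x ≤? j) ×-dec (y ≤? j) ×-dec ∀? λ u → (x ≤? u) →-dec (y ≤? u) →-dec (j ≤? u)

  private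
    TallJoin-free : A → Set
    TallJoin-free b = ∀ x → _⋖_ _≤_ b x → ∀ y → _⋖_ _≤_ b y → x ≢ y →
                      ∀ g → _⋖_ _≤_ x g → ∀ j → _⋖_ _≤_ g j → ¬ IsJoin (A , _≤_) x y j

  noTallJoin? : U.Decidable (λ b → ¬ TallJoin (A , _≤_) b)
  noTallJoin? b = map′ uncurried curried
    (∀? λ x → (b ⋖? x) →-dec ∀? λ y → (b ⋖? y) →-dec ¬? (x ≟ y) →-dec
     ∀? λ g → (x ⋖? g) →-dec ∀? λ j → (g ⋖? j) →-dec ¬? (isJoin? x y j))
    where
    uncurried : TallJoin-free b → ¬ TallJoin (A , _≤_) b
    uncurried h t = let open TallJoin t in h x b⋖x y b⋖y x≢y g x⋖g j g⋖j x∨y≡j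
    curried : ¬ TallJoin (A , _≤_) b → TallJoin-free b
    curried h x b⋖x y b⋖y x≢y g x⋖g j g⋖j x∨y≡j = h (record
      { x = x ; y = y ; g = g ; j = j ; b⋖x = b⋖x ; b⋖y = b⋖y ; x≢y = x≢y
      ; x⋖g = x⋖g ; g⋖j = g⋖j ; x∨y≡j = x∨y≡j })

∀-Bool? : Exhaustible Bool
∀-Bool? P? = map′ (λ (t , f) → λ where true → t ; false → f) (λ h → h true , h false)
  (P? true ×-dec P? false)

∀-Maybe? : ∀ {A} → Exhaustible A → Exhaustible (Maybe A)
∀-Maybe? ∀? P? = map′ (λ (n , j) → λ where nothing → n ; (just a) → j a)
  (λ h → h nothing , λ a → h (just a)) (P? nothing ×-dec ∀? (λ a → P? (just a)))

∀-Vec? : ∀ {A} → Exhaustible A → ∀ n → Exhaustible (Vec A n)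
∀-Vec? ∀? zero P? = map′ (λ p → λ where [] → p) (λ h → h []) (P? [])
∀-Vec? ∀? (suc n) P? = map′ (λ h → λ where (x ∷ xs) → h x xs) (λ h x xs → h (x ∷ xs))
  (∀? λ x → ∀-Vec? ∀? n λ xs → P? (x ∷ xs))

data _⊑_ : Rel (Maybe Bool) 0ℓ where
  nothing⊑ : ∀ {m} → nothing ⊑ m
  just⊑    : ∀ {b} → just b ⊑ just b

_⊑?_ : Decidable _⊑_
nothing ⊑? _ = yes nothing⊑
just _ ⊑? nothing = no λ ()
just b ⊑? just c with b Bool.≟ c
... | yes refl = yes just⊑
... | no b≢c   = no λ where just⊑ → b≢c refl

-- OctFace stores a
-- proper face as a function, so equal vertex sets need not give equal faces and ⊆F is only a
-- preorder; CrossFace 3 is its skeleton (see crossFace≅).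
data CrossFace (n : ℕ) : Set where
  proper : Vec (Maybe Bool) n → CrossFace n
  whole  : CrossFace n

data _≤ᶜ_ {n} : Rel (CrossFace n) 0ℓ where
  proper≤proper : ∀ {u v} → Pointwise _⊑_ u v → proper u ≤ᶜ proper v
  ≤whole        : ∀ {f} → f ≤ᶜ whole

CrossFacePoset : ℕ → Σ Set (λ A → Rel A 0ℓ)
CrossFacePoset n = CrossFace n , _≤ᶜ_

empty : ∀ n → CrossFace n
empty n = proper (replicate n nothing)

_≤ᶜ?_ : ∀ {n} → Decidable (_≤ᶜ_ {n})
proper u ≤ᶜ? proper v =
  map′ proper≤proper (λ where (proper≤proper p) → p) (Pointwise.decidable _⊑?_ u v)
proper u ≤ᶜ? whole = yes ≤whole
whole ≤ᶜ? proper v = no λ ()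
whole ≤ᶜ? whole = yes ≤whole

_≟ᶜ_ : ∀ {n} → DecidableEquality (CrossFace n)
proper u ≟ᶜ proper v =
  map′ (cong proper) (λ where refl → refl) (Vec.≡-dec (Maybe.≡-dec Bool._≟_) u v)
proper u ≟ᶜ whole = no λ ()
whole ≟ᶜ proper v = no λ ()
whole ≟ᶜ whole = yes refl

∀-CrossFace? : ∀ n → Exhaustible (CrossFace n)
∀-CrossFace? n P? = map′ (λ (p , w) → λ where (proper u) → p u ; whole → w)
  (λ h → (λ u → h (proper u)) , h whole)
  (∀-Vec? (∀-Maybe? ∀-Bool?) n (λ u → P? (proper u)) ×-dec P? whole)

≤empty⇒≡empty : ∀ {n} {f : CrossFace n} → f ≤ᶜ empty n → f ≡ empty n
≤empty⇒≡empty (proper≤proper u⊑∅) = cong proper (⊑∅⇒≡∅ u⊑∅)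
  where
  ⊑∅⇒≡∅ : ∀ {n} {u : Vec (Maybe Bool) n} → Pointwise _⊑_ u (replicate n nothing) →
          u ≡ replicate n nothing
  ⊑∅⇒≡∅ []               = refl
  ⊑∅⇒≡∅ (nothing⊑ ∷ u⊑∅) = cong (nothing ∷_) (⊑∅⇒≡∅ u⊑∅)

⟦_⟧ : CrossFace 3 → OctFace
⟦ proper u ⟧ = proper (lookup u)
⟦ whole ⟧    = whole

⌊_⌋ : OctFace → CrossFace 3
⌊ proper s ⌋ = proper (tabulate s)
⌊ whole ⌋    = whole

⌊⌋∘⟦⟧ : ∀ f → ⌊ ⟦ f ⟧ ⌋ ≡ f
⌊⌋∘⟦⟧ (proper u) = cong proper (tabulate∘lookup u)
⌊⌋∘⟦⟧ whole      = refl

⟦⟧∘⌊⌋⊆ : ∀ F → ⟦ ⌊ F ⌋ ⟧ ⊆F F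
⟦⟧∘⌊⌋⊆ (proper s) (i , _) e = trans (sym (lookup∘tabulate s i)) e
⟦⟧∘⌊⌋⊆ whole      _       _ = tt

⊆⟦⟧∘⌊⌋ : ∀ F → F ⊆F ⟦ ⌊ F ⌋ ⟧
⊆⟦⟧∘⌊⌋ (proper s) (i , _) e = trans (lookup∘tabulate s i) e
⊆⟦⟧∘⌊⌋ whole      _       _ = tt

⊑⇒just : ∀ {m m′ b} → m ⊑ m′ → m ≡ just b → m′ ≡ just b
⊑⇒just just⊑ e = e

just⇒⊑ : ∀ {m m′} → (∀ {b} → m ≡ just b → m′ ≡ just b) → m ⊑ m′
just⇒⊑ {nothing} _ = nothing⊑
just⇒⊑ {just b}  h with h refl
... | refl = just⊑

⟦⟧-mono : ∀ {f g} → f ≤ᶜ g → ⟦ f ⟧ ⊆F ⟦ g ⟧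
⟦⟧-mono (proper≤proper u⊑v) (i , _) = ⊑⇒just (Pointwise.lookup u⊑v i)
⟦⟧-mono ≤whole                _       _ = tt

⟦⟧-reflects : ∀ {f g} → ⟦ f ⟧ ⊆F ⟦ g ⟧ → f ≤ᶜ g
⟦⟧-reflects {proper u} {proper v} u⊆v =
  proper≤proper (subst₂ (Pointwise _⊑_) (tabulate∘lookup u) (tabulate∘lookup v)
    (Pointwise.tabulate⁺ λ i → just⇒⊑ λ {b} → u⊆v (i , b)))
⟦⟧-reflects {whole} {proper v} whole⊆v
  with trans (sym (whole⊆v (zero , true) tt)) (whole⊆v (zero , false) tt)
... | ()
⟦⟧-reflects {_} {whole} _ = ≤whole

crossFace≅ : ∀ {b ℓ} {Q : Σ (Set b) (λ B → Rel B ℓ)} →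
             OctFaceLattice ≅ₚ Q → Antisymmetric _≡_ (proj₂ Q) → CrossFacePoset 3 ≅ₚ Q
crossFace≅ i antisym = record
  { to       = to ∘ ⟦_⟧
  ; from     = ⌊_⌋ ∘ from
  ; from∘to  = λ f → trans (cong ⌊_⌋ (from∘to ⟦ f ⟧)) (⌊⌋∘⟦⟧ f)
  ; to∘from  = λ y → trans (antisym (mono (⟦⟧∘⌊⌋⊆ (from y))) (mono (⊆⟦⟧∘⌊⌋ (from y)))) (to∘from y)
  ; mono     = mono ∘ ⟦⟧-mono
  ; reflects = ⟦⟧-reflects ∘ reflects
  }
  where open _≅ₚ_ i

open FiniteDecidable {CrossFace 3} _≟ᶜ_ _≤ᶜ?_ (∀-CrossFace? 3)

no-tallJoin-above-empty : ¬ TallJoin (CrossFacePoset 3) (empty 3)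
no-tallJoin-above-empty = from-yes (noTallJoin? (empty 3))

no-tallJoin-above-minimum : ∀ {b} → Minimum _≤ᶜ_ b → ¬ TallJoin (CrossFacePoset 3) b
no-tallJoin-above-minimum b≤ =
  subst (λ b → ¬ TallJoin (CrossFacePoset 3) b) (sym (≤empty⇒≡empty (b≤ (empty 3))))
    no-tallJoin-above-empty

vertex : CrossFace 3
vertex = proper (just true ∷ nothing ∷ nothing ∷ [])

tallJoin-above-vertex : TallJoin (CrossFacePoset 3) vertex
tallJoin-above-vertex = record
  { x = edge₁ ; y = edge₂ ; g = triangle ; j = whole
  ; b⋖x = from-yes (vertex ⋖? edge₁)
  ; b⋖y = from-yes (vertex ⋖? edge₂)
  ; x≢y = λ ()
  ; x⋖g = from-yes (edge₁ ⋖? triangle)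
  ; g⋖j = from-yes (triangle ⋖? whole)
  ; x∨y≡j = from-yes (isJoin? edge₁ edge₂ whole)
  }
  where
  edge₁ edge₂ triangle : CrossFace 3
  edge₁ = proper (just true ∷ just true ∷ nothing ∷ [])
  edge₂ = proper (just true ∷ just false ∷ nothing ∷ [])
  triangle = proper (just true ∷ just true ∷ just true ∷ [])

proposition5p5 : ∀ {a ℓ : Level} (L : UphoLattice a ℓ) (t : UphoLattice.Carrier L)
               → UphoLattice.IsJoinOfAtoms L t
               → ¬ (OctFaceLattice ≅ₚ UphoLattice.Core L t)
proposition5p5 L t (atoms≤t , _) oct≅core =
  no-tallJoin-above-minimum (to-minimum core≅faces 𝟘-minimum)
                            (to-tallJoin core≅faces tallJoin-above-𝟘)
  where
  open UphoLattice L using (𝟘; minimum; Core)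
  faces≅core : CrossFacePoset 3 ≅ₚ Core t
  faces≅core = crossFace≅ oct≅core (core-antisym L t)
  core≅faces : Core t ≅ₚ CrossFacePoset 3
  core≅faces = ≅ₚ-sym faces≅core
  𝟘-minimum : Minimum (proj₂ (Core t)) (𝟘 , minimum t)
  𝟘-minimum (x , _) = minimum x
  tallJoin-above-𝟘 : TallJoin (Core t) (𝟘 , minimum t)
  tallJoin-above-𝟘 =
    tallJoin-𝟘⇒core L atoms≤t
      (tallJoin⇒tallJoin-𝟘 L
        (ideal-tallJoin⇒tallJoin L (to-tallJoin faces≅core tallJoin-above-vertex)))
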